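{- For any integer $g\ge 3$ there exists a constant $c<1$ such that $$\bigl|\{n\le x:\ n=p_1+p_2,\ p_1 \text{ and } p_2 \text{ are base } g \text{ palindromes}\}\bigr|\le cx$$ for all sufficiently large $x$.
   Context: Here $n$ ranges over positive integers. Every nonnegative integer has a unique base $g$ representation $\delta_{l-1}\cdots\delta_0$ with digits $0\le \delta_j\le g-1$ and $\delta_{l-1}\ne 0$; it is a base $g$ palindrome if $\delta_{l-i}=\delta_{i-1}$ for all $i=1,\dots,\lfloor l/2\rfloor$. By convention $0$ is also considered a base $g$ palindrome. -}

module Defs where

open import Data.Nat using (ℕ; zero; suc; _+_; _*_; _∸_; _<_; _≤_; NonZero; s≤s; z≤n)
open import Data.Nat.Properties using (anyUpTo?; m+n∸m≡n; m≤m+n; ≤-trans; n<1+n; _≟_)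
open import Data.Nat.DivMod using (_/_; _%_)
open import Data.List using (List; []; _∷_; reverse; filter; length; map; upTo)
open import Data.List.Properties using (≡-dec)
open import Data.Product using (∃; ∃-syntax; _×_; _,_)
open import Relation.Nullary using (Dec; yes; no)
open import Relation.Nullary.Decidable using (map′; _×-dec_)
open import Relation.Binary.PropositionalEquality using (_≡_; refl; sym; cong)

-- Base-g digits of n, least significant digit first, with no leading
-- (most significant) zeros; digits g 0 = [] .  The first argument of
-- digitsAux is fuel; n steps of fuel suffice for g ≥ 2.
digitsAux : (g : ℕ) → .{{NonZero g}} → ℕ → ℕ → List ℕ
digitsAux g zero    n       = []
digitsAux g (suc k) zero    = []
digitsAux g (suc k) (suc m) = (suc m % g) ∷ digitsAux g k (suc m / g)

digits : (g : ℕ) → .{{NonZero g}} → ℕ → List ℕ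
digits g n = digitsAux g n n

-- n is a base g palindrome: its digit string reads the same reversed
-- (0, with empty digit string, is a palindrome by convention).
IsPalindrome : (g : ℕ) → .{{NonZero g}} → ℕ → Set
IsPalindrome g n = reverse (digits g n) ≡ digits g n

isPalindrome? : (g : ℕ) → .{{_ : NonZero g}} → (n : ℕ) → Dec (IsPalindrome g n)
isPalindrome? g n = ≡-dec _≟_ (reverse (digits g n)) (digits g n)

SumOfTwoPalindromes : (g : ℕ) → .{{NonZero g}} → ℕ → Set
SumOfTwoPalindromes g n =
  ∃[ p₁ ] ∃[ p₂ ] (IsPalindrome g p₁ × IsPalindrome g p₂ × n ≡ p₁ + p₂)

private
  ≤⇒<suc : ∀ {a b} → a ≤ b → a < suc b
  ≤⇒<suc p = s≤s p

sumOfTwoPalindromes? : (g : ℕ) → .{{_ : NonZero g}} → (n : ℕ) →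
                       Dec (SumOfTwoPalindromes g n)
sumOfTwoPalindromes? g n =
  map′ to from (anyUpTo? (λ p → isPalindrome? g p ×-dec isPalindrome? g (n ∸ p)) (suc n))
  where
  to : ∃ (λ p → p < suc n × (IsPalindrome g p × IsPalindrome g (n ∸ p))) →
       SumOfTwoPalindromes g n
  to (p , s≤s p≤n , a , b) = p , n ∸ p , a , b , sym (lemma p n p≤n)
    where
    lemma : ∀ p n → p ≤ n → p + (n ∸ p) ≡ n
    lemma zero n _ = refl
    lemma (suc p) (suc n) (s≤s q) = cong suc (lemma p n q)
  from : SumOfTwoPalindromes g n →
         ∃ (λ p → p < suc n × (IsPalindrome g p × IsPalindrome g (n ∸ p)))
  from (p₁ , p₂ , a , b , refl) =
    p₁ , ≤⇒<suc (m≤m+n p₁ p₂) , a , subst' (m+n∸m≡n p₁ p₂) b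
    where
    subst' : ∀ {x y} → x ≡ y → IsPalindrome g y → IsPalindrome g x
    subst' refl q = q

countSums : (g : ℕ) → .{{NonZero g}} → ℕ → ℕ
countSums g x = length (filter (sumOfTwoPalindromes? g) (map suc (upTo x)))

module Submission where

-- Let M ≥ 2. If n has leading digits g−1, g−1 in positions M+1, M and ends in the digits 0, g−1,
-- then n is not a sum of two palindromes p + q. The units digit forces x₀ + y₀ = g − 1
-- without carry, so the tens digit forces x₁ + y₁ ∈ {0, g}. The part of p above position M
-- is at most two digits, and since p is a palindrome it is 0, x₀ or x₀g + x₁; likewise for q.
-- A short case analysis shows that these two parts add up to at most g² − g or to exactly g²,
-- whereas the leading part g² − 1 of n needs a sum of g² − 1 or g² − 2 (g ≥ 3).
-- These n form, below g^(M+2), an arithmetic progression of g^(M−2) terms with difference g²,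
-- so at least a fraction g⁻⁵ of the integers in [1, x] are not sums once x ≥ g⁴.

open import Defs
open import Data.Nat.Base
  using (ℕ; zero; suc; pred; _+_; _*_; _∸_; _^_; _<_; _≤_; _≥_; _≤′_; ≤′-refl; ≤′-step; NonZero; s≤s; s≤s⁻¹; z≤n)
open import Data.Nat.Properties
open import Data.Nat.DivMod
open import Data.Nat.Induction using (<-wellFounded)
open import Data.Nat.Tactic.RingSolver using (solve-∀)
open import Data.List.Base using ([]; _∷_; _++_; [_]; reverse; filter; length; map; upTo)
open import Data.List.Properties
  using (∷-injective; reverse-++; filter-accept; filter-reject; filter-++; map-++; length-++; length-map; length-upTo; upTo-∷ʳ)
open import Data.Product.Base using (∃-syntax; _×_; _,_; proj₁; proj₂)
open import Data.Sum.Base using (_⊎_; inj₁; inj₂)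
open import Data.Empty using (⊥; ⊥-elim)
open import Induction.WellFounded using (Acc; acc)
open import Relation.Nullary using (¬_; yes; no)
open import Relation.Unary using (Pred; Decidable)
open import Relation.Unary.Properties using (∁?)
open import Relation.Binary.PropositionalEquality hiding ([_])

module _ {d : ℕ} .{{_ : NonZero d}} where

  [m*d+r]%d≡r : ∀ m {r} → r < d → (m * d + r) % d ≡ r
  [m*d+r]%d≡r m {r} r<d = begin
    (m * d + r) % d  ≡⟨ %-congˡ (+-comm (m * d) r) ⟩
    (r + m * d) % d  ≡⟨ [m+kn]%n≡m%n r m d ⟩
    r % d            ≡⟨ m<n⇒m%n≡m r<d ⟩
    r                ∎
    where open ≡-Reasoning

  [m*d+r]/d≡m : ∀ m {r} → r < d → (m * d + r) / d ≡ m
  [m*d+r]/d≡m m {r} r<d = begin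
    (m * d + r) / d    ≡⟨ +-distrib-/ (m * d) r no-carry ⟩
    m * d / d + r / d  ≡⟨ cong₂ _+_ (m*n/n≡m m d) (m<n⇒m/n≡0 r<d) ⟩
    m + 0              ≡⟨ +-identityʳ m ⟩
    m                  ∎
    where
    open ≡-Reasoning
    no-carry : m * d % d + r % d < d
    no-carry = subst (_< d) (sym (cong₂ _+_ (m*n%n≡0 m d) (m<n⇒m%n≡m r<d))) r<d

  +-divMod : ∀ a b → a + b ≡ (a / d + b / d) * d + (a % d + b % d)
  +-divMod a b = trans (cong₂ _+_ (m≡m%n+[m/n]*n a d) (m≡m%n+[m/n]*n b d))
                       (regroup (a % d) (a / d) (b % d) (b / d) d)
    where
    regroup : ∀ r q s t d → r + q * d + (s + t * d) ≡ (q + t) * d + (r + s)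
    regroup = solve-∀

  +-carry : ∀ a b →
    (a % d + b % d ≡ (a + b) % d × (a + b) / d ≡ a / d + b / d) ⊎
    (a % d + b % d ≡ d + (a + b) % d × (a + b) / d ≡ suc (a / d + b / d))
  +-carry a b with a % d + b % d <? d
  ... | yes r<d = inj₁ ( sym (trans (%-congˡ (+-divMod a b)) ([m*d+r]%d≡r (a / d + b / d) r<d))
                       , trans (/-congˡ (+-divMod a b)) ([m*d+r]/d≡m (a / d + b / d) r<d))
  ... | no r≮d = inj₂ ( trans (sym d+r′≡r) (cong (d +_) (sym (trans (%-congˡ a+b≡) ([m*d+r]%d≡r (suc q) r′<d))))
                      , trans (/-congˡ a+b≡) ([m*d+r]/d≡m (suc q) r′<d))
    where
    r′ = a % d + b % d ∸ d
    d+r′≡r : d + r′ ≡ a % d + b % d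
    d+r′≡r = m+[n∸m]≡n (≮⇒≥ r≮d)
    r′<d : r′ < d
    r′<d = +-cancelˡ-< d r′ d (subst (_< d + d) (sym d+r′≡r) (+-mono-< (m%n<n a d) (m%n<n b d)))
    q = a / d + b / d
    a+b≡ : a + b ≡ suc q * d + r′
    a+b≡ = begin
      a + b                      ≡⟨ +-divMod a b ⟩
      q * d + (a % d + b % d)    ≡⟨ cong (q * d +_) d+r′≡r ⟨
      q * d + (d + r′)           ≡⟨ +-assoc (q * d) d r′ ⟨
      q * d + d + r′             ≡⟨ cong (_+ r′) (+-comm (q * d) d) ⟩
      suc q * d + r′             ∎
      where open ≡-Reasoning

module _ {g : ℕ} .{{_ : NonZero g}} (1<g : 1 < g) where

  private
    suc-/-≤ : ∀ n → suc n / g ≤ n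
    suc-/-≤ n = s≤s⁻¹ (m/n<m (suc n) g 1<g)

  digitsAux-fuel : ∀ {a b n} → n ≤ a → n ≤ b → digitsAux g a n ≡ digitsAux g b n
  digitsAux-fuel {zero}  {zero}          z≤n z≤n = refl
  digitsAux-fuel {zero}  {suc b}         z≤n _   = refl
  digitsAux-fuel {suc a} {zero}          _   z≤n = refl
  digitsAux-fuel {suc a} {suc b} {zero}  _   _   = refl
  digitsAux-fuel {suc a} {suc b} {suc n} (s≤s n≤a) (s≤s n≤b) =
    cong (suc n % g ∷_) (digitsAux-fuel (≤-trans (suc-/-≤ n) n≤a) (≤-trans (suc-/-≤ n) n≤b))

  digits-step : ∀ {p} → 0 < p → digits g p ≡ p % g ∷ digits g (p / g)
  digits-step {suc n} _ = cong (suc n % g ∷_) (digitsAux-fuel (suc-/-≤ n) ≤-refl)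

  digits-< : ∀ {p} → 0 < p → p < g → digits g p ≡ [ p ]
  digits-< {p} 0<p p<g = begin
    digits g p                ≡⟨ digits-step 0<p ⟩
    p % g ∷ digits g (p / g)  ≡⟨ cong₂ (λ r q → r ∷ digits g q) (m<n⇒m%n≡m p<g) (m<n⇒m/n≡0 p<g) ⟩
    [ p ]                     ∎
    where open ≡-Reasoning

  digits-head : ∀ {p a as} → digits g p ≡ a ∷ as → p % g ≡ a × digits g (p / g) ≡ as
  digits-head {suc n} eq = ∷-injective (trans (sym (digits-step (s≤s z≤n))) eq)

  digits-last-nonzero : ∀ {p} → 0 < p → ∃[ ys ] ∃[ e ] (0 < e × digits g p ≡ ys ++ [ e ])
  digits-last-nonzero {p} = go (<-wellFounded p)
    where
    go : ∀ {p} → Acc _<_ p → 0 < p → ∃[ ys ] ∃[ e ] (0 < e × digits g p ≡ ys ++ [ e ])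
    go {p@(suc _)} (acc rec) 0<p with p <? g
    ... | yes p<g = [] , p , 0<p , digits-< 0<p p<g
    ... | no p≮g with go (rec (m/n<m p g 1<g)) (m≥n⇒m/n>0 (≮⇒≥ p≮g))
    ...   | ys , e , 0<e , eq = p % g ∷ ys , e , 0<e , trans (digits-step 0<p) (cong (p % g ∷_) eq)

  digits-/-^ : ∀ j {p} .{{_ : NonZero (g ^ j)}} → g ^ j ≤ p →
    ∃[ ys ] digits g p ≡ ys ++ digits g (p / g ^ j)
  digits-/-^ zero {p} _ = [] , cong (digits g) (sym (n/1≡n p))
  digits-/-^ (suc j) {p} gʲ⁺¹≤p with digits-/-^ j {{m^n≢0 g j}} gʲ≤p/g
    where
    gʲ≤p/g : g ^ j ≤ p / g
    gʲ≤p/g = subst (_≤ p / g) (m*n/n≡m (g ^ j) g) (/-monoˡ-≤ g (subst (_≤ p) (*-comm g (g ^ j)) gʲ⁺¹≤p))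
  ... | ys , eq = p % g ∷ ys , (begin
    digits g p                                  ≡⟨ digits-step (<-≤-trans (m^n>0 g (suc j)) gʲ⁺¹≤p) ⟩
    p % g ∷ digits g (p / g)                    ≡⟨ cong (p % g ∷_) eq ⟩
    p % g ∷ ys ++ digits g (p / g / g ^ j)      ≡⟨ cong (λ q → p % g ∷ ys ++ digits g q) (m/n/o≡m/[n*o] p g (g ^ j)) ⟩
    p % g ∷ ys ++ digits g (p / g ^ suc j)      ∎)
    where
    open ≡-Reasoning
    instance
      gʲ≢0 : NonZero (g ^ j)
      gʲ≢0 = m^n≢0 g j

  palindrome-prefix : ∀ j {p} .{{_ : NonZero (g ^ j)}} → IsPalindrome g p → g ^ j ≤ p →
    ∃[ zs ] digits g p ≡ reverse (digits g (p / g ^ j)) ++ zs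
  palindrome-prefix j {p} pal gʲ≤p with digits-/-^ j gʲ≤p
  ... | ys , eq = reverse ys , (begin
    digits g p                                     ≡⟨ pal ⟨
    reverse (digits g p)                           ≡⟨ cong reverse eq ⟩
    reverse (ys ++ digits g (p / g ^ j))           ≡⟨ reverse-++ ys _ ⟩
    reverse (digits g (p / g ^ j)) ++ reverse ys   ∎)
    where open ≡-Reasoning

  palindrome-%≡0⇒≡0 : ∀ {p} → IsPalindrome g p → p % g ≡ 0 → p ≡ 0
  palindrome-%≡0⇒≡0 {zero} _ _ = refl
  palindrome-%≡0⇒≡0 {p@(suc _)} pal p%g≡0 with digits-last-nonzero {p} (s≤s z≤n)
  ... | ys , e , 0<e , eq = ⊥-elim (>⇒≢ 0<e (trans e≡p%g p%g≡0))
    where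
    e≡p%g : e ≡ p % g
    e≡p%g = sym (proj₁ (digits-head (trans (sym pal) (trans (cong reverse eq) (reverse-++ ys [ e ])))))

-- For a palindrome p with units digit x₀ and tens digit x₁, a part A = p / g ^ j of at most
-- two digits is that pair of low digits read backwards (or nothing); the condition in
-- no-digits holds because a palindrome ending in 0 is 0.
data LeadingPart (g : ℕ) : ℕ → ℕ → ℕ → Set where
  no-digits  : ∀ {x₀ x₁} → (x₀ ≡ 0 → x₁ ≡ 0) → LeadingPart g 0 x₀ x₁
  one-digit  : ∀ {x₀ x₁} → 0 < x₀ → LeadingPart g x₀ x₀ x₁
  two-digits : ∀ {x₀ x₁} → LeadingPart g (x₀ * g + x₁) x₀ x₁

module _ {g : ℕ} .{{_ : NonZero g}} (1<g : 1 < g) where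

  prefix-leadingPart : ∀ {A p} → A < g * g → (p % g ≡ 0 → p / g % g ≡ 0) →
    (0 < A → ∃[ zs ] digits g p ≡ reverse (digits g A) ++ zs) →
    LeadingPart g A (p % g) (p / g % g)
  prefix-leadingPart {zero} _ x₀≡0⇒x₁≡0 _ = no-digits x₀≡0⇒x₁≡0
  prefix-leadingPart {A@(suc _)} {p} A<g² _ prefix with A <? g | prefix (s≤s z≤n)
  ... | yes A<g | zs , eq = subst (λ x → LeadingPart g A x (p / g % g)) A≡x₀ (one-digit (s≤s z≤n))
    where
    A≡x₀ : A ≡ p % g
    A≡x₀ = sym (proj₁ (digits-head 1<g (trans eq (cong (λ ds → reverse ds ++ zs) (digits-< 1<g (s≤s z≤n) A<g)))))
  ... | no A≮g | zs , eq = subst (λ a → LeadingPart g a (p % g) (p / g % g)) (sym A≡x₀g+x₁) two-digits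
    where
    digits-A : digits g A ≡ A % g ∷ [ A / g ]
    digits-A = trans (digits-step 1<g (s≤s z≤n))
                     (cong (A % g ∷_) (digits-< 1<g (m≥n⇒m/n>0 (≮⇒≥ A≮g)) (m<n*o⇒m/o<n A<g²)))
    low-digits : p % g ≡ A / g × digits g (p / g) ≡ A % g ∷ zs
    low-digits = digits-head 1<g (trans eq (cong (λ ds → reverse ds ++ zs) digits-A))
    A≡x₀g+x₁ : A ≡ p % g * g + p / g % g
    A≡x₀g+x₁ = begin
      A                      ≡⟨ m≡m%n+[m/n]*n A g ⟩
      A % g + A / g * g      ≡⟨ +-comm (A % g) (A / g * g) ⟩
      A / g * g + A % g      ≡⟨ cong₂ (λ x₀ x₁ → x₀ * g + x₁) (proj₁ low-digits) (proj₁ (digits-head 1<g (proj₂ low-digits))) ⟨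
      p % g * g + p / g % g  ∎
      where open ≡-Reasoning

  palindrome-leadingPart : ∀ j {p} .{{_ : NonZero (g ^ j)}} → IsPalindrome g p → p / g ^ j < g * g →
    LeadingPart g (p / g ^ j) (p % g) (p / g % g)
  palindrome-leadingPart j {p} pal A<g² = prefix-leadingPart A<g² x₀≡0⇒x₁≡0
    (λ 0<A → palindrome-prefix 1<g j pal (m/n≢0⇒n≤m (>⇒≢ 0<A)))
    where
    x₀≡0⇒x₁≡0 : p % g ≡ 0 → p / g % g ≡ 0
    x₀≡0⇒x₁≡0 x₀≡0 rewrite palindrome-%≡0⇒≡0 1<g pal x₀≡0 =
      trans (%-congˡ (0/n≡0 g)) (m<n⇒m%n≡m (<-trans (s≤s z≤n) 1<g))

module _ {g : ℕ} .{{_ : NonZero g}} where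

  leadingPart-≤ : ∀ {A x₀ x₁} → LeadingPart g A x₀ x₁ → A ≤ x₀ * g + x₁
  leadingPart-≤ (no-digits _)                 = z≤n
  leadingPart-≤ {x₀ = x₀} {x₁} (one-digit _) = ≤-trans (m≤m*n x₀ g) (m≤m+n (x₀ * g) x₁)
  leadingPart-≤ two-digits                    = ≤-refl

  leadingPart-gap : ∀ {A x₀ x₁} → LeadingPart g A x₀ x₁ → 0 < x₁ →
    A ≡ x₀ * g + x₁ ⊎ A + g ≤ x₀ * g + x₁
  leadingPart-gap {x₀ = zero} (no-digits x₀≡0⇒x₁≡0) 0<x₁ = ⊥-elim (>⇒≢ 0<x₁ (x₀≡0⇒x₁≡0 refl))
  leadingPart-gap {x₀ = suc x₀} {x₁} (no-digits _) _ = inj₂ (≤-trans (m≤m+n g (x₀ * g)) (m≤m+n _ x₁))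
  leadingPart-gap {x₀ = suc x₀} {x₁} (one-digit _) 0<x₁ = inj₂ (begin
    suc x₀ + g           ≡⟨ regroup x₀ g ⟩
    g + x₀ + 1           ≤⟨ +-mono-≤ (+-monoʳ-≤ g (m≤m*n x₀ g)) 0<x₁ ⟩
    g + x₀ * g + x₁      ∎)
    where
    open ≤-Reasoning
    regroup : ∀ x g → suc x + g ≡ g + x + 1
    regroup = solve-∀
  leadingPart-gap two-digits _ = inj₁ refl

  leadingParts-sum : ∀ {A B x₀ x₁ y₀ y₁} → LeadingPart g A x₀ x₁ → LeadingPart g B y₀ y₁ →
    x₁ < g → y₁ < g → suc (x₀ + y₀) ≡ g → x₁ + y₁ ≡ 0 ⊎ x₁ + y₁ ≡ g →
    A + B + g ≤ g * g ⊎ A + B ≡ g * g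
  leadingParts-sum {A} {B} {x₀} {x₁} {y₀} {y₁} lpA lpB x₁<g y₁<g units tens = from-tens tens
    where
    X = x₀ * g + x₁
    Y = y₀ * g + y₁
    X+Y+g≡ : X + Y + g ≡ g * g + (x₁ + y₁)
    X+Y+g≡ = trans (regroup x₀ x₁ y₀ y₁ g) (cong (λ s → s * g + (x₁ + y₁)) units)
      where
      regroup : ∀ x₀ x₁ y₀ y₁ g → x₀ * g + x₁ + (y₀ * g + y₁) + g ≡ suc (x₀ + y₀) * g + (x₁ + y₁)
      regroup = solve-∀
    X+Y≡g² : x₁ + y₁ ≡ g → X + Y ≡ g * g
    X+Y≡g² t = +-cancelʳ-≡ g (X + Y) (g * g) (trans X+Y+g≡ (cong (g * g +_) t))
    +-right-comm : ∀ a b c → a + b + c ≡ a + c + b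
    +-right-comm = solve-∀
    A+B≤X+Y : A + B ≤ X + Y
    A+B≤X+Y = +-mono-≤ (leadingPart-≤ lpA) (leadingPart-≤ lpB)
    summand-positive : ∀ {x y} → x + y ≡ g → y < g → 0 < x
    summand-positive {zero}  x+y≡g y<g = ⊥-elim (<⇒≢ y<g x+y≡g)
    summand-positive {suc _} _     _   = s≤s z≤n
    from-tens : x₁ + y₁ ≡ 0 ⊎ x₁ + y₁ ≡ g → A + B + g ≤ g * g ⊎ A + B ≡ g * g
    from-tens (inj₁ t) = inj₁ (≤-trans (+-monoˡ-≤ g A+B≤X+Y)
                                  (≤-reflexive (trans X+Y+g≡ (trans (cong (g * g +_) t) (+-identityʳ (g * g))))))
    from-tens (inj₂ t) with leadingPart-gap lpA (summand-positive t y₁<g)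
                     | leadingPart-gap lpB (summand-positive (trans (+-comm y₁ x₁) t) x₁<g)
    ... | inj₁ A≡X   | inj₁ B≡Y   = inj₂ (trans (cong₂ _+_ A≡X B≡Y) (X+Y≡g² t))
    ... | inj₂ A+g≤X | _          = inj₁ (begin
      A + B + g   ≡⟨ +-right-comm A B g ⟩
      A + g + B   ≤⟨ +-mono-≤ A+g≤X (leadingPart-≤ lpB) ⟩
      X + Y       ≡⟨ X+Y≡g² t ⟩
      g * g       ∎)
      where open ≤-Reasoning
    ... | inj₁ _     | inj₂ B+g≤Y = inj₁ (begin
      A + B + g   ≡⟨ +-assoc A B g ⟩
      A + (B + g) ≤⟨ +-mono-≤ (leadingPart-≤ lpA) B+g≤Y ⟩
      X + Y       ≡⟨ X+Y≡g² t ⟩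
      g * g       ∎)
      where open ≤-Reasoning

¬sumOfTwoPalindromes : ∀ {g} .{{_ : NonZero g}} j {n} .{{_ : NonZero (g ^ j)}} → 3 ≤ g →
  suc (n % g) ≡ g → n / g % g ≡ 0 → suc (n / g ^ j) ≡ g * g → ¬ SumOfTwoPalindromes g n
¬sumOfTwoPalindromes {g} j 3≤g units tens top (p , q , pal-p , pal-q , refl) =
  impossible (leadingParts-sum (palindrome-leadingPart 1<g j pal-p A<g²) (palindrome-leadingPart 1<g j pal-q B<g²)
                               (m%n<n (p / g) g) (m%n<n (q / g) g) (proj₁ units-sum) tens-sum)
  where
  1<g : 1 < g
  1<g = ≤-trans (s≤s (s≤s z≤n)) 3≤g
  A = p / g ^ j
  B = q / g ^ j
  N = (p + q) / g ^ j

  units-sum : suc (p % g + q % g) ≡ g × (p + q) / g ≡ p / g + q / g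
  units-sum with +-carry {g} p q
  ... | inj₁ (x₀+y₀≡ , no-carry) = trans (cong suc x₀+y₀≡) units , no-carry
  ... | inj₂ (x₀+y₀≡ , _) = ⊥-elim (<⇒≢ (+-mono-<-≤ (m%n<n p g) y₀≤) x₀+y₀≡)
    where
    y₀≤ : q % g ≤ (p + q) % g
    y₀≤ = s≤s⁻¹ (subst (q % g <_) (sym units) (m%n<n q g))

  tens′ : (p / g + q / g) % g ≡ 0
  tens′ = trans (%-congˡ (sym (proj₂ units-sum))) tens

  tens-sum : p / g % g + q / g % g ≡ 0 ⊎ p / g % g + q / g % g ≡ g
  tens-sum with +-carry {g} (p / g) (q / g)
  ... | inj₁ (x₁+y₁≡ , _) = inj₁ (trans x₁+y₁≡ tens′)
  ... | inj₂ (x₁+y₁≡ , _) = inj₂ (trans x₁+y₁≡ (trans (cong (g +_) tens′) (+-identityʳ g)))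

  top-bounds : A + B ≤ N × N ≤ suc (A + B)
  top-bounds with +-carry {g ^ j} p q
  ... | inj₁ (_ , N≡) = ≤-reflexive (sym N≡) , ≤-trans (≤-reflexive N≡) (n≤1+n (A + B))
  ... | inj₂ (_ , N≡) = ≤-trans (n≤1+n (A + B)) (≤-reflexive (sym N≡)) , ≤-reflexive N≡

  N<g² : N < g * g
  N<g² = subst (N <_) top ≤-refl
  A<g² : A < g * g
  A<g² = ≤-<-trans (≤-trans (m≤m+n A B) (proj₁ top-bounds)) N<g²
  B<g² : B < g * g
  B<g² = ≤-<-trans (≤-trans (m≤n+m B A) (proj₁ top-bounds)) N<g²

  impossible : A + B + g ≤ g * g ⊎ A + B ≡ g * g → ⊥
  impossible (inj₁ A+B+g≤g²) = <-irrefl refl (begin-strict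
    g * g        ≡⟨ top ⟨
    suc N        ≤⟨ s≤s (proj₂ top-bounds) ⟩
    2 + (A + B)  <⟨ +-monoˡ-< (A + B) 3≤g ⟩
    g + (A + B)  ≡⟨ +-comm g (A + B) ⟩
    A + B + g    ≤⟨ A+B+g≤g² ⟩
    g * g        ∎)
    where open ≤-Reasoning
  impossible (inj₂ A+B≡g²) = <-irrefl refl (begin-strict
    g * g  ≡⟨ A+B≡g² ⟨
    A + B  ≤⟨ proj₁ top-bounds ⟩
    N      <⟨ N<g² ⟩
    g * g  ∎)
    where open ≤-Reasoning

count : ∀ {ℓ} {P : Pred ℕ ℓ} → Decidable P → ℕ → ℕ
count P? x = length (filter P? (map suc (upTo x)))

module _ {ℓ} {P : Pred ℕ ℓ} (P? : Decidable P) where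

  length-filter+length-filter-∁ : ∀ xs → length (filter P? xs) + length (filter (∁? P?) xs) ≡ length xs
  length-filter+length-filter-∁ [] = refl
  length-filter+length-filter-∁ (x ∷ xs) with P? x
  ... | yes _ = cong suc (length-filter+length-filter-∁ xs)
  ... | no  _ = trans (+-suc _ _) (cong suc (length-filter+length-filter-∁ xs))

  count+count-∁ : ∀ x → count P? x + count (∁? P?) x ≡ x
  count+count-∁ x = begin
    count P? x + count (∁? P?) x  ≡⟨ length-filter+length-filter-∁ (map suc (upTo x)) ⟩
    length (map suc (upTo x))     ≡⟨ length-map suc (upTo x) ⟩
    length (upTo x)               ≡⟨ length-upTo x ⟩
    x                             ∎
    where open ≡-Reasoning

  count-suc : ∀ x → count P? (suc x) ≡ count P? x + length (filter P? [ suc x ])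
  count-suc x = begin
    length (filter P? (map suc (upTo (suc x))))                ≡⟨ cong (λ xs → length (filter P? (map suc xs))) (upTo-∷ʳ x) ⟨
    length (filter P? (map suc (upTo x ++ [ x ])))             ≡⟨ cong (λ xs → length (filter P? xs)) (map-++ suc (upTo x) [ x ]) ⟩
    length (filter P? (map suc (upTo x) ++ [ suc x ]))         ≡⟨ cong length (filter-++ P? (map suc (upTo x)) [ suc x ]) ⟩
    length (filter P? (map suc (upTo x)) ++ filter P? [ suc x ]) ≡⟨ length-++ (filter P? (map suc (upTo x))) ⟩
    count P? x + length (filter P? [ suc x ])                  ∎
    where open ≡-Reasoning

  count-≤-suc : ∀ x → count P? x ≤ count P? (suc x)
  count-≤-suc x = subst (count P? x ≤_) (sym (count-suc x)) (m≤m+n _ _)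

  count-suc-accept : ∀ {x} → P (suc x) → count P? (suc x) ≡ suc (count P? x)
  count-suc-accept {x} px = begin
    count P? (suc x)                           ≡⟨ count-suc x ⟩
    count P? x + length (filter P? [ suc x ])  ≡⟨ cong (λ l → count P? x + length l) (filter-accept P? px) ⟩
    count P? x + 1                             ≡⟨ +-comm (count P? x) 1 ⟩
    suc (count P? x)                           ∎
    where open ≡-Reasoning

  count-mono : ∀ {x y} → x ≤ y → count P? x ≤ count P? y
  count-mono x≤y = go (≤⇒≤′ x≤y)
    where
    go : ∀ {x y} → x ≤′ y → count P? x ≤ count P? y
    go ≤′-refl        = ≤-refl
    go (≤′-step x≤′y) = ≤-trans (go x≤′y) (count-≤-suc _)

  count-progression : ∀ a e c m → 0 < c → c ≤ e → (∀ i → i < m → P (a + e * i + c)) →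
    m ≤ count P? (a + e * m)
  count-progression a e c zero _ _ _ = z≤n
  count-progression a e c@(suc c′) (suc m) 0<c c≤e P-terms = begin
    suc m                            ≤⟨ s≤s (count-progression a e c m 0<c c≤e (λ i i<m → P-terms i (m<n⇒m<1+n i<m))) ⟩
    suc (count P? (a + e * m))       ≤⟨ s≤s (count-mono (m≤m+n (a + e * m) c′)) ⟩
    suc (count P? (a + e * m + c′))  ≡⟨ count-suc-accept (subst P (+-suc (a + e * m) c′) (P-terms m ≤-refl)) ⟨
    count P? (suc (a + e * m + c′))  ≤⟨ count-mono last-term≤ ⟩
    count P? (a + e * suc m)         ∎
    where
    open ≤-Reasoning
    last-term≤ : suc (a + e * m + c′) ≤ a + e * suc m
    last-term≤ = begin
      suc (a + e * m + c′)  ≡⟨ +-suc (a + e * m) c′ ⟨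
      a + e * m + c         ≤⟨ +-monoʳ-≤ (a + e * m) c≤e ⟩
      a + e * m + e         ≡⟨ regroup a e m ⟩
      a + e * suc m         ∎
      where
      regroup : ∀ a e m → a + e * m + e ≡ a + e * suc m
      regroup = solve-∀

module _ {g : ℕ} .{{_ : NonZero g}} (3≤g : 3 ≤ g) where

  private
    1<g : 1 < g
    1<g = ≤-trans (s≤s (s≤s z≤n)) 3≤g

    instance
      g²≢0 : NonZero (g * g)
      g²≢0 = m*n≢0 g g

    pred[n]<n : ∀ n .{{_ : NonZero n}} → pred n < n
    pred[n]<n n = m≤pred[n]⇒suc[m]≤n ≤-refl

  nonSumCount : ℕ → ℕ
  nonSumCount = count (∁? (sumOfTwoPalindromes? g))

  -- In base g this number reads (g−1)(g−1) i 0 (g−1), with i padded to h digits.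
  ¬sum-progression : ∀ h {i} → i < g ^ h →
    ¬ SumOfTwoPalindromes g (pred (g * g) * g ^ (2 + h) + g * g * i + pred g)
  ¬sum-progression h {i} i<gʰ = ¬sumOfTwoPalindromes (2 + h) 3≤g units tens top
    where
    instance
      gʰ≢0 : NonZero (g ^ h)
      gʰ≢0 = m^n≢0 g h
      gʰ⁺¹≢0 : NonZero (g ^ (1 + h))
      gʰ⁺¹≢0 = m^n≢0 g (1 + h)
      gʰ⁺²≢0 : NonZero (g ^ (2 + h))
      gʰ⁺²≢0 = m^n≢0 g (2 + h)
    T = pred (g * g)
    m = (T * g ^ h + i) * g
    n = T * g ^ (2 + h) + g * g * i + pred g
    n≡m*g+pred-g : n ≡ m * g + pred g
    n≡m*g+pred-g = regroup T g (g ^ h) i (pred g)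
      where
      regroup : ∀ T g G i c → T * (g * (g * G)) + g * g * i + c ≡ (T * G + i) * g * g + c
      regroup = solve-∀
    n/g≡m : n / g ≡ m
    n/g≡m = trans (/-congˡ n≡m*g+pred-g) ([m*d+r]/d≡m m (pred[n]<n g))
    units : suc (n % g) ≡ g
    units = trans (cong suc (trans (%-congˡ n≡m*g+pred-g) ([m*d+r]%d≡r m (pred[n]<n g)))) (suc-pred g)
    tens : n / g % g ≡ 0
    tens = trans (%-congˡ n/g≡m) (m*n%n≡0 (T * g ^ h + i) g)
    top : suc (n / g ^ (2 + h)) ≡ g * g
    top = trans (cong suc (begin
      n / g ^ (2 + h)        ≡⟨ m/n/o≡m/[n*o] n g (g ^ (1 + h)) ⟨
      n / g / g ^ (1 + h)    ≡⟨ /-congˡ {o = g ^ (1 + h)} n/g≡m ⟩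
      m / g ^ (1 + h)        ≡⟨ m/n/o≡m/[n*o] m g (g ^ h) ⟨
      m / g / g ^ h          ≡⟨ /-congˡ {o = g ^ h} (m*n/n≡m (T * g ^ h + i) g) ⟩
      (T * g ^ h + i) / g ^ h ≡⟨ [m*d+r]/d≡m T i<gʰ ⟩
      T                      ∎)) (suc-pred (g * g))
      where open ≡-Reasoning

  nonSumCount-≥ : ∀ h → g ^ h ≤ nonSumCount (g ^ (4 + h))
  nonSumCount-≥ h = subst (λ x → g ^ h ≤ nonSumCount x) end≡
    (count-progression (∁? (sumOfTwoPalindromes? g)) (T * g ^ (2 + h)) (g * g) (pred g) (g ^ h)
      (suc[m]≤n⇒m≤pred[n] 1<g) (≤-trans pred[n]≤n (m≤m*n g g)) (λ i i<gʰ → ¬sum-progression h i<gʰ))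
    where
    T = pred (g * g)
    end≡ : T * g ^ (2 + h) + g * g * g ^ h ≡ g ^ (4 + h)
    end≡ = begin
      T * g ^ (2 + h) + g * g * g ^ h  ≡⟨ regroup T g (g ^ h) ⟩
      suc T * g ^ (2 + h)              ≡⟨ cong (_* g ^ (2 + h)) (suc-pred (g * g)) ⟩
      g * g * g ^ (2 + h)              ≡⟨ *-assoc g g (g ^ (2 + h)) ⟩
      g ^ (4 + h)                      ∎
      where
      open ≡-Reasoning
      regroup : ∀ T g G → T * (g * (g * G)) + g * g * G ≡ suc T * (g * (g * G))
      regroup = solve-∀

  n<g^n : ∀ n → n < g ^ n
  n<g^n zero    = s≤s z≤n
  n<g^n (suc n) = ≤-<-trans (n<g^n n) (^-monoʳ-< g 1<g (n<1+n n))

  nonSumCount-linear : ∀ x → g ^ 4 ≤ x → x ≤ g ^ 5 * nonSumCount x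
  nonSumCount-linear x g⁴≤x = go x g⁴≤x (<-≤-trans (n<g^n x) (^-monoʳ-≤ g (m≤n+m x 4)))
    where
    go : ∀ h {x} → g ^ 4 ≤ x → x < g ^ (4 + h) → x ≤ g ^ 5 * nonSumCount x
    go zero    g⁴≤x x<g⁴ = ⊥-elim (<⇒≱ x<g⁴ g⁴≤x)
    go (suc h) {x} g⁴≤x x<g⁵⁺ʰ with x <? g ^ (4 + h)
    ... | yes x<g⁴⁺ʰ = go h g⁴≤x x<g⁴⁺ʰ
    ... | no x≮g⁴⁺ʰ = begin
      x                                 ≤⟨ <⇒≤ x<g⁵⁺ʰ ⟩
      g ^ (5 + h)                       ≡⟨ ^-distribˡ-+-* g 5 h ⟩
      g ^ 5 * g ^ h                     ≤⟨ *-monoʳ-≤ (g ^ 5) (nonSumCount-≥ h) ⟩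
      g ^ 5 * nonSumCount (g ^ (4 + h)) ≤⟨ *-monoʳ-≤ (g ^ 5) (count-mono _ (≮⇒≥ x≮g⁴⁺ʰ)) ⟩
      g ^ 5 * nonSumCount x             ∎
      where open ≤-Reasoning

  countSums-≤ : ∀ x → g ^ 4 ≤ x → g ^ 5 * countSums g x ≤ pred (g ^ 5) * x
  countSums-≤ x g⁴≤x = +-cancelʳ-≤ x (K * S) (pred K * x) (begin
    K * S + x         ≤⟨ +-monoʳ-≤ (K * S) (nonSumCount-linear x g⁴≤x) ⟩
    K * S + K * N     ≡⟨ *-distribˡ-+ K S N ⟨
    K * (S + N)       ≡⟨ cong (K *_) (count+count-∁ (sumOfTwoPalindromes? g) x) ⟩
    K * x             ≡⟨ cong (_* x) (suc-pred K {{m^n≢0 g 5}}) ⟨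
    suc (pred K) * x  ≡⟨ +-comm x (pred K * x) ⟩
    pred K * x + x    ∎)
    where
    open ≤-Reasoning
    K = g ^ 5
    S = countSums g x
    N = nonSumCount x

theorem1p3 : (g : ℕ) → .{{_ : NonZero g}} → 3 ≤ g →
    ∃[ a ] ∃[ b ] (a < b × ∃[ x₀ ] ((x : ℕ) → x ≥ x₀ → b * countSums g x ≤ a * x))
theorem1p3 g 3≤g =
  pred (g ^ 5) , g ^ 5 , m≤pred[n]⇒suc[m]≤n {{m^n≢0 g 5}} ≤-refl , g ^ 4 , countSums-≤ 3≤g
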